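{- Let $k$ be a prime and $1\le i\le k-1$. Then for every non-negative integer $n$, $k^n$ divides $E_{nk+i|k}$.
   Context: For a permutation $\pi=a_1\ldots a_N$ of $\{1,\ldots,N\}$, $\mathrm{Des}(\pi)=\{j:1\le j<N,\ a_j>a_{j+1}\}$. The generalized Euler number $E_{N|k}$ is the number of permutations $\pi$ of $\{1,\ldots,N\}$ with $\mathrm{Des}(\pi)=\{k,2k,3k,\ldots\}\cap\{1,\ldots,N-1\}$. -}

module Defs where

open import Data.Nat using (ℕ; zero; suc; _<?_)
open import Data.Nat.Divisibility using (_∣?_)
open import Data.Bool using (Bool; true; false; _∧_; not)
open import Data.Bool.Properties using () renaming (_≟_ to _≟B_)
open import Data.Fin using (Fin; toℕ; _≟_)
open import Data.Vec using (Vec; []; _∷_; lookup)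
open import Data.List using (List; []; _∷_; concatMap; map; filterᵇ; length; allFin)
open import Data.Vec using (toList)
open import Relation.Nullary.Decidable using (⌊_⌋)

-- A permutation a₁ … a_N of {1,…,N} is represented (shifted by one) as a
-- vector of length N with entries in Fin N having no repeated entries.

allVecs : (N m : ℕ) → List (Vec (Fin N) m)
allVecs N zero = [] ∷ []
allVecs N (suc m) = concatMap (λ x → map (x ∷_) (allVecs N m)) (allFin N)

noneEq : ∀ {N} → Fin N → List (Fin N) → Bool
noneEq x [] = true
noneEq x (y ∷ ys) = not ⌊ x ≟ y ⌋ ∧ noneEq x ys

distinct : ∀ {N m} → Vec (Fin N) m → Bool
distinct [] = true
distinct (x ∷ xs) = noneEq x (toList xs) ∧ distinct xs

perms : (N : ℕ) → List (Vec (Fin N) N)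
perms N = filterᵇ distinct (allVecs N N)

-- Checks, for a vector a₁ … a_m starting at position p (so the first entry
-- is a_p), that for every j with p ≤ j < p+m-1:
--   a_j > a_{j+1}  iff  k ∣ j.
-- Thus Des(π) = {k,2k,3k,…} ∩ {1,…,N-1} iff desOK k 1 π.
desOK : ∀ {N m} → (k p : ℕ) → Vec (Fin N) m → Bool
desOK k p [] = true
desOK k p (x ∷ []) = true
desOK k p (x ∷ y ∷ ys) =
  ⌊ ⌊ toℕ y <? toℕ x ⌋ ≟B ⌊ k ∣? p ⌋ ⌋ ∧ desOK k (suc p) (y ∷ ys)

E : ℕ → ℕ → ℕ
E N k = length (filterᵇ (desOK k 1) (perms N))

{-# OPTIONS --safe #-}
-- Only the relative order of the entries matters, so E N k counts the arrangements of a word of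
-- ascent/descent/free steps, which satisfy an Entringer-type recursion. In a permutation counted by
-- E (N + 1) k the largest entry sits at a peak: either last, which is possible iff k ∤ N, or at a
-- position s + 1 divisible by k, where it cuts the permutation into independent blocks of lengths s
-- and d = N − s. Hence
--   E (N + 1) k = [k ∤ N] E N k + Σ_{k ∣ s + 1} C(N, s) E s k E d k.
-- Let N + 1 = n k + i with 0 < i < k and k prime. Then s = j k + (k − 1) and d = (n − 1 − j) k + i,
-- so by induction E s k and E d k contribute k ^ j and k ^ (n − 1 − j), and k ∣ C(N, s) because
-- d C(N, s) = (s + 1) C(N, s + 1) with k ∤ d; the last term is handled by induction on i.
module Submission where

open import Defs
open import Data.Nat using (ℕ; _+_; _*_; _^_; _≤_; _∸_)
open import Data.Nat.Divisibility using (_∣_)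
open import Data.Nat.Primality using (Prime)

open import Data.Bool using (Bool; true; false; _∧_; not; if_then_else_; T)
open import Data.Bool.Properties using (∧-commutativeMonoid; ∧-identityʳ; ∧-zeroʳ; T-∧)
  renaming (_≟_ to _≟B_)
open import Data.Fin using (Fin; zero; suc; toℕ; _≟_)
import Data.Fin.Properties as Fin
open import Data.List
  using (List; []; _∷_; _++_; map; length; concatMap; filterᵇ; allFin; tabulate; take; drop)
open import Data.List.Properties
  using (map-++; map-∘; map-cong; map-cong-local; map-id; map-tabulate; tabulate-cong; ++-assoc)
open import Data.List.Relation.Unary.All as All using (All; []; _∷_)
open import Data.List.Relation.Unary.All.Properties using (++⁺; map⁺)
open import Data.Nat using (zero; suc; _<_; _<?_; z≤n; s≤s)
open import Data.Nat.Combinatorics using (_C_; nC1≡n; k>n⇒nCk≡0; nCk+nC[k+1]≡[n+1]C[k+1])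
open import Data.Nat.Divisibility
  using (divides; _∣?_; _∣0; 1∣_; ∣⇒≤; ∣m+n∣m⇒∣n; ∣m∣n⇒∣m+n; ∣m⇒∣m*n; n∣m*n; *-pres-∣)
open import Data.Nat.Induction using (<-rec)
open import Data.Nat.ListAction using (sum)
open import Data.Nat.ListAction.Properties using (sum-++)
open import Data.Nat.Primality using (euclidsLemma)
open import Data.Nat.Properties
  using (+-assoc; +-comm; +-suc; +-identityʳ; +-cancelˡ-≡; *-zeroʳ; *-identityʳ; *-distribˡ-+;
         *-distribʳ-+; ^-distribˡ-+-*; suc-injective; ≤-refl; ≤-trans; ≤-reflexive; m≤m+n; m≤n+m;
         n≤1+n; m≤n⇒m≤1+n; <⇒≱; ≤⇒≯)
open import Data.Nat.Tactic.RingSolver using (solve-∀)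
open import Data.Product using (∃-syntax; _×_; _,_; proj₂)
open import Data.Sum using (_⊎_; inj₁; inj₂; [_,_]′)
open import Data.Unit using (⊤; tt)
open import Data.Vec using (Vec; []; _∷_; toList)
open import Function using (_∘_; id; _⇔_; Equivalence; mk⇔)
open import Relation.Binary.PropositionalEquality
open import Relation.Nullary using (¬_; Dec; contradiction)
open import Relation.Nullary.Decidable
  using (⌊_⌋; isYes≗does; dec-true; dec-false; does-⇔; toWitness; toWitnessFalse; ⌊⌋-map′)
open import Algebra.Solver.CommutativeMonoid ∧-commutativeMonoid using (solve; _⊕_; _⊜_)

open ≡-Reasoning

private
  variable
    A X Y : Set

⌊⌋-true : (a? : Dec A) → A → ⌊ a? ⌋ ≡ true
⌊⌋-true a? a = trans (isYes≗does a?) (dec-true a? a)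

⌊⌋-false : (a? : Dec A) → ¬ A → ⌊ a? ⌋ ≡ false
⌊⌋-false a? ¬a = trans (isYes≗does a?) (dec-false a? ¬a)

⌊⌋-cong : {B : Set} → A ⇔ B → (a? : Dec A) (b? : Dec B) → ⌊ a? ⌋ ≡ ⌊ b? ⌋
⌊⌋-cong A⇔B a? b? = trans (isYes≗does a?) (trans (does-⇔ A⇔B a? b?) (sym (isYes≗does b?)))

⌊suc<?suc⌋ : ∀ m n → ⌊ suc m <? suc n ⌋ ≡ ⌊ m <? n ⌋
⌊suc<?suc⌋ m n = ⌊⌋-cong (mk⇔ (λ { (s≤s m<n) → m<n }) s≤s) (suc m <? suc n) (m <? n)

iverson : Bool → ℕ
iverson b = if b then 1 else 0

countᵇ : (X → Bool) → List X → ℕ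
countᵇ P []       = 0
countᵇ P (x ∷ xs) = iverson (P x) + countᵇ P xs

filterᵇ-filterᵇ : (P Q : X → Bool) (xs : List X) →
                  filterᵇ Q (filterᵇ P xs) ≡ filterᵇ (λ x → P x ∧ Q x) xs
filterᵇ-filterᵇ P Q [] = refl
filterᵇ-filterᵇ P Q (x ∷ xs) with P x
... | false = filterᵇ-filterᵇ P Q xs
... | true with Q x
...   | true  = cong (x ∷_) (filterᵇ-filterᵇ P Q xs)
...   | false = filterᵇ-filterᵇ P Q xs

length-filterᵇ : (P : X → Bool) (xs : List X) → length (filterᵇ P xs) ≡ countᵇ P xs
length-filterᵇ P [] = refl
length-filterᵇ P (x ∷ xs) with P x
... | true  = cong suc (length-filterᵇ P xs)
... | false = length-filterᵇ P xs

countᵇ-++ : (P : X → Bool) (xs ys : List X) → countᵇ P (xs ++ ys) ≡ countᵇ P xs + countᵇ P ys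
countᵇ-++ P []       ys = refl
countᵇ-++ P (x ∷ xs) ys =
  trans (cong (iverson (P x) +_) (countᵇ-++ P xs ys)) (sym (+-assoc (iverson (P x)) _ _))

countᵇ-concatMap : (P : Y → Bool) (g : X → List Y) (xs : List X) →
                   countᵇ P (concatMap g xs) ≡ sum (map (countᵇ P ∘ g) xs)
countᵇ-concatMap P g []       = refl
countᵇ-concatMap P g (x ∷ xs) =
  trans (countᵇ-++ P (g x) (concatMap g xs)) (cong (countᵇ P (g x) +_) (countᵇ-concatMap P g xs))

countᵇ-map : (P : Y → Bool) (h : X → Y) (xs : List X) → countᵇ P (map h xs) ≡ countᵇ (P ∘ h) xs
countᵇ-map P h []       = refl
countᵇ-map P h (x ∷ xs) = cong (iverson (P (h x)) +_) (countᵇ-map P h xs)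

countᵇ-cong : {P Q : X → Bool} → P ≗ Q → (xs : List X) → countᵇ P xs ≡ countᵇ Q xs
countᵇ-cong P≗Q []       = refl
countᵇ-cong P≗Q (x ∷ xs) = cong₂ _+_ (cong iverson (P≗Q x)) (countᵇ-cong P≗Q xs)

countᵇ-false : (xs : List X) → countᵇ (λ _ → false) xs ≡ 0
countᵇ-false []       = refl
countᵇ-false (x ∷ xs) = countᵇ-false xs

countᵇ-guard : (b : Bool) (Q : X → Bool) (xs : List X) →
               countᵇ (λ x → b ∧ Q x) xs ≡ (if b then countᵇ Q xs else 0)
countᵇ-guard true  Q xs = refl
countᵇ-guard false Q xs = countᵇ-false xs

if-∧ : ∀ b c {n m : ℕ} → (b ≡ true → (if c then n else 0) ≡ m) →
       (if b ∧ c then n else 0) ≡ (if b then m else 0)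
if-∧ true  c eq = eq refl
if-∧ false c eq = refl

sum-map-++ : (f : X → ℕ) (xs ys : List X) →
             sum (map f (xs ++ ys)) ≡ sum (map f xs) + sum (map f ys)
sum-map-++ f xs ys = trans (cong sum (map-++ f xs ys)) (sum-++ (map f xs) (map f ys))

sum-map-scale : {f g : X → ℕ} (K : ℕ) {xs : List X} →
                All (λ x → f x ≡ K * g x) xs → sum (map f xs) ≡ K * sum (map g xs)
sum-map-scale K []       = sym (*-zeroʳ K)
sum-map-scale K (e ∷ es) = trans (cong₂ _+_ e (sum-map-scale K es)) (sym (*-distribˡ-+ K _ _))

if-sum-map : (b : Bool) (f : X → ℕ) (xs : List X) →
             (if b then sum (map f xs) else 0) ≡ sum (map (λ x → if b then f x else 0) xs)
if-sum-map true  f xs       = refl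
if-sum-map false f []       = refl
if-sum-map false f (x ∷ xs) = if-sum-map false f xs

∣-sum-map : {d : ℕ} (f : X → ℕ) {xs : List X} → All (λ x → d ∣ f x) xs → d ∣ sum (map f xs)
∣-sum-map f []         = _ ∣0
∣-sum-map f (d∣ ∷ d∣s) = ∣m∣n⇒∣m+n d∣ (∣-sum-map f d∣s)

sumFrom : ℕ → ℕ → (ℕ → ℕ) → ℕ
sumFrom c zero    h = 0
sumFrom c (suc n) h = h c + sumFrom (suc c) n h

sumFrom-cong : ∀ c n {h h′ : ℕ → ℕ} → (∀ i → i < n → h (c + i) ≡ h′ (c + i)) →
               sumFrom c n h ≡ sumFrom c n h′
sumFrom-cong c zero    eq = refl
sumFrom-cong c (suc n) {h} {h′} eq = cong₂ _+_
  (subst (λ j → h j ≡ h′ j) (+-identityʳ c) (eq 0 (s≤s z≤n)))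
  (sumFrom-cong (suc c) n λ i i<n → subst (λ j → h j ≡ h′ j) (+-suc c i) (eq (suc i) (s≤s i<n)))

sumFrom-zero : ∀ c n → sumFrom c n (λ _ → 0) ≡ 0
sumFrom-zero c zero    = refl
sumFrom-zero c (suc n) = sumFrom-zero (suc c) n

sumFrom-+ : ∀ c n (h h′ : ℕ → ℕ) →
            sumFrom c n (λ j → h j + h′ j) ≡ sumFrom c n h + sumFrom c n h′
sumFrom-+ c zero    h h′ = refl
sumFrom-+ c (suc n) h h′ =
  trans (cong (h c + h′ c +_) (sumFrom-+ (suc c) n h h′)) (interchange (h c) (h′ c) _ _)
  where
  interchange : ∀ a b x y → a + b + (x + y) ≡ a + x + (b + y)
  interchange = solve-∀

sumFrom-sum : ∀ c n (G : X → ℕ → ℕ) (xs : List X) →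
              sumFrom c n (λ j → sum (map (λ x → G x j) xs)) ≡ sum (map (λ x → sumFrom c n (G x)) xs)
sumFrom-sum c n G []       = sumFrom-zero c n
sumFrom-sum c n G (x ∷ xs) =
  trans (sumFrom-+ c n (G x) _) (cong (sumFrom c n (G x) +_) (sumFrom-sum c n G xs))

sumFrom-last : ∀ c n h → sumFrom c (suc n) h ≡ sumFrom c n h + h (c + n)
sumFrom-last c zero    h = trans (+-identityʳ (h c)) (cong h (sym (+-identityʳ c)))
sumFrom-last c (suc n) h = begin
  h c + sumFrom (suc c) (suc n) h             ≡⟨ cong (h c +_) (sumFrom-last (suc c) n h) ⟩
  h c + (sumFrom (suc c) n h + h (suc c + n)) ≡⟨ +-assoc (h c) _ _ ⟨
  h c + sumFrom (suc c) n h + h (suc c + n)   ≡⟨ cong (λ j → h c + sumFrom (suc c) n h + h j) (+-suc c n) ⟨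
  h c + sumFrom (suc c) n h + h (c + suc n)   ∎

size : ∀ {N} → (Fin N → Bool) → ℕ
size {zero}  B = 0
size {suc N} B = iverson (B zero) + size (B ∘ suc)

rank : ∀ {N} → (Fin N → Bool) → Fin N → ℕ
rank B zero    = 0
rank B (suc x) = iverson (B zero) + rank (B ∘ suc) x

delete : ∀ {N} → (Fin N → Bool) → Fin N → Fin N → Bool
delete B x y = B y ∧ not ⌊ x ≟ y ⌋

size-cong : ∀ {N} {B B′ : Fin N → Bool} → B ≗ B′ → size B ≡ size B′
size-cong {zero}  eq = refl
size-cong {suc N} eq = cong₂ _+_ (cong iverson (eq zero)) (size-cong (eq ∘ suc))

rank-cong : ∀ {N} {B B′ : Fin N → Bool} → B ≗ B′ → rank B ≗ rank B′
rank-cong eq zero    = refl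
rank-cong eq (suc x) = cong₂ _+_ (cong iverson (eq zero)) (rank-cong (eq ∘ suc) x)

delete-suc : ∀ {N} (B : Fin (suc N) → Bool) x → delete B (suc x) ∘ suc ≗ delete (B ∘ suc) x
delete-suc B x y = cong (λ b → B (suc y) ∧ not b) (⌊⌋-map′ (cong suc) Fin.suc-injective (x ≟ y))

delete-self : ∀ {N} (B : Fin N → Bool) x → delete B x x ≡ false
delete-self B x = trans (cong (λ b → B x ∧ not b) (⌊⌋-true (x ≟ x) refl)) (∧-zeroʳ (B x))

rank-delete : ∀ {N} (B : Fin N → Bool) x → rank (delete B x) x ≡ rank B x
rank-delete B zero    = refl
rank-delete B (suc x) = cong₂ _+_ (cong iverson (∧-identityʳ (B zero)))
  (trans (rank-cong (delete-suc B x) x) (rank-delete (B ∘ suc) x))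

size-delete : ∀ {N} (B : Fin N → Bool) x → B x ≡ true → suc (size (delete B x)) ≡ size B
size-delete B zero B0 = begin
  suc (iverson (B zero ∧ false) + size (delete B zero ∘ suc))
    ≡⟨ cong suc (cong₂ _+_ (cong iverson (∧-zeroʳ (B zero))) (size-cong (∧-identityʳ ∘ B ∘ suc))) ⟩
  suc (size (B ∘ suc))
    ≡⟨ cong (λ b → iverson b + size (B ∘ suc)) B0 ⟨
  size B ∎
size-delete B (suc x) Bx = begin
  suc (iverson (B zero ∧ true) + size (delete B (suc x) ∘ suc))
    ≡⟨ cong suc (cong₂ _+_ (cong iverson (∧-identityʳ (B zero))) (size-cong (delete-suc B x))) ⟩
  suc (iverson (B zero) + size (delete (B ∘ suc) x))
    ≡⟨ +-suc (iverson (B zero)) _ ⟨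
  iverson (B zero) + suc (size (delete (B ∘ suc) x))
    ≡⟨ cong (iverson (B zero) +_) (size-delete (B ∘ suc) x Bx) ⟩
  size B ∎

rank-<? : ∀ {N} (B : Fin N → Bool) x y → B x ≡ true → B y ≡ false →
          ⌊ rank B x <? rank B y ⌋ ≡ ⌊ toℕ x <? toℕ y ⌋
rank-<? B zero    zero    Bx By = contradiction (trans (sym Bx) By) λ ()
rank-<? B zero    (suc y) Bx By = cong (λ b → ⌊ 0 <? iverson b + rank (B ∘ suc) y ⌋) Bx
rank-<? B (suc x) zero    Bx By = cong (λ b → ⌊ iverson b + rank (B ∘ suc) x <? 0 ⌋) By
rank-<? B (suc x) (suc y) Bx By = begin
  ⌊ iverson (B zero) + rank (B ∘ suc) x <? iverson (B zero) + rank (B ∘ suc) y ⌋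
    ≡⟨ shift (B zero) ⟩
  ⌊ rank (B ∘ suc) x <? rank (B ∘ suc) y ⌋
    ≡⟨ rank-<? (B ∘ suc) x y Bx By ⟩
  ⌊ toℕ x <? toℕ y ⌋
    ≡⟨ ⌊suc<?suc⌋ (toℕ x) (toℕ y) ⟨
  ⌊ toℕ (suc x) <? toℕ (suc y) ⌋ ∎
  where
  shift : ∀ b → ⌊ iverson b + rank (B ∘ suc) x <? iverson b + rank (B ∘ suc) y ⌋
                ≡ ⌊ rank (B ∘ suc) x <? rank (B ∘ suc) y ⌋
  shift true  = ⌊suc<?suc⌋ _ _
  shift false = refl

sum-rank : ∀ {N} (B : Fin N → Bool) (h : ℕ → ℕ) c →
           sum (tabulate (λ x → if B x then h (c + rank B x) else 0)) ≡ sumFrom c (size B) h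
sum-rank {zero}  B h c = refl
sum-rank {suc N} B h c = begin
  first (B zero) + sum (tabulate (λ x → if B (suc x) then h (c + (iverson (B zero) + rank B′ x)) else 0))
    ≡⟨ cong (first (B zero) +_) (cong sum (tabulate-cong λ x →
         cong (λ j → if B (suc x) then h j else 0) (+-assoc c _ _))) ⟨
  first (B zero) + sum (tabulate (λ x → if B (suc x) then h (c + iverson (B zero) + rank B′ x) else 0))
    ≡⟨ cong (first (B zero) +_) (sum-rank B′ h (c + iverson (B zero))) ⟩
  first (B zero) + sumFrom (c + iverson (B zero)) (size B′) h
    ≡⟨ absorb (B zero) ⟩
  sumFrom c (size B) h ∎
  where
  B′ = B ∘ suc
  first : Bool → ℕ
  first b = if b then h (c + 0) else 0
  absorb : ∀ b → first b + sumFrom (c + iverson b) (size B′) h ≡ sumFrom c (iverson b + size B′) h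
  absorb true  = cong₂ (λ i j → h i + sumFrom j (size B′) h) (+-identityʳ c) (+-comm c 1)
  absorb false = cong (λ j → sumFrom j (size B′) h) (+-identityʳ c)

allIn : ∀ {N m} → (Fin N → Bool) → Vec (Fin N) m → Bool
allIn B []       = true
allIn B (x ∷ xs) = B x ∧ allIn B xs

allIn-all : ∀ {N m} (xs : Vec (Fin N) m) → allIn (λ _ → true) xs ≡ true
allIn-all []       = refl
allIn-all (x ∷ xs) = allIn-all xs

allIn-delete : ∀ {N m} (B : Fin N → Bool) x (xs : Vec (Fin N) m) →
               allIn (delete B x) xs ≡ allIn B xs ∧ noneEq x (toList xs)
allIn-delete B x []       = sym (∧-identityʳ true)
allIn-delete B x (y ∷ ys) =
  trans (cong (delete B x y ∧_) (allIn-delete B x ys)) (interchange (B y) _ _ _)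
  where
  interchange : ∀ a b c d → (a ∧ b) ∧ (c ∧ d) ≡ (a ∧ c) ∧ (b ∧ d)
  interchange = solve 4 (λ a b c d → (a ⊕ b) ⊕ (c ⊕ d) ⊜ (a ⊕ c) ⊕ (b ⊕ d)) refl

countᵇ-allVecs-byRank : ∀ {N m} (P : Vec (Fin N) (suc m) → Bool) (B : Fin N → Bool) (h : ℕ → ℕ) →
  (∀ x → countᵇ (P ∘ (x ∷_)) (allVecs N m) ≡ (if B x then h (rank B x) else 0)) →
  countᵇ P (allVecs N (suc m)) ≡ sumFrom 0 (size B) h
countᵇ-allVecs-byRank {N} {m} P B h byFirst = begin
  countᵇ P (concatMap (λ x → map (x ∷_) (allVecs N m)) (allFin N))
    ≡⟨ countᵇ-concatMap P _ (allFin N) ⟩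
  sum (map (λ x → countᵇ P (map (x ∷_) (allVecs N m))) (allFin N))
    ≡⟨ cong sum (map-cong (λ x → countᵇ-map P (x ∷_) (allVecs N m)) (allFin N)) ⟩
  sum (map (λ x → countᵇ (P ∘ (x ∷_)) (allVecs N m)) (allFin N))
    ≡⟨ cong sum (map-tabulate {n = N} id (λ x → countᵇ (P ∘ (x ∷_)) (allVecs N m))) ⟩
  sum (tabulate (λ x → countᵇ (P ∘ (x ∷_)) (allVecs N m)))
    ≡⟨ cong sum (tabulate-cong byFirst) ⟩
  sum (tabulate (λ x → if B x then h (rank B x) else 0))
    ≡⟨ sum-rank B h 0 ⟩
  sumFrom 0 (size B) h ∎

-- Words of steps and their arrangements

data Step : Set where
  asc desc free : Step

Word : Set
Word = List Step

-- admits c b: the step c lets the next value be smaller (b = true) or larger (b = false)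
-- than the previous one.
admits : Step → Bool → Bool
admits asc  b = not b
admits desc b = b
admits free _ = true

descentIf : Bool → Step
descentIf b = if b then desc else asc

admits-descentIf : ∀ d b → ⌊ b ≟B d ⌋ ≡ admits (descentIf d) b
admits-descentIf true  true  = refl
admits-descentIf true  false = refl
admits-descentIf false true  = refl
admits-descentIf false false = refl

descent-admitted : ∀ b → T (admits (descentIf b) true) → T b
descent-admitted true t = t

ascent-admitted : ∀ b → T (admits (descentIf b) false) → T (not b)
ascent-admitted false t = t

stepAt : ℕ → ℕ → Step
stepAt k p = descentIf ⌊ k ∣? p ⌋

-- The steps after positions p, …, p + m − 1 of a permutation whose descents are at the multiples of k.
steps : ℕ → ℕ → ℕ → Word
steps k p zero    = []
steps k p (suc m) = stepAt k p ∷ steps k (suc p) m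

-- arrangements w r: the number of ways to list the |w| values still available so that consecutive
-- values obey w, given that the value listed before them exceeds exactly r of them. Only relative
-- order matters, so the available value exceeding exactly j of the others is represented by j.
arrangements : Word → ℕ → ℕ
arrangements []      r = 1
arrangements (c ∷ w) r =
  sumFrom 0 (suc (length w)) λ j → if admits c ⌊ j <? r ⌋ then arrangements w j else 0

arrangements₀ : Word → ℕ
arrangements₀ w = arrangements w 0

-- The first entry has no predecessor, hence the free step.
eulerWord : ℕ → ℕ → Word
eulerWord k zero    = []
eulerWord k (suc M) = free ∷ steps k 1 M

length-steps : ∀ k p m → length (steps k p m) ≡ m
length-steps k p zero    = refl
length-steps k p (suc m) = cong suc (length-steps k (suc p) m)

length-eulerWord : ∀ k N → length (eulerWord k N) ≡ N
length-eulerWord k zero    = refl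
length-eulerWord k (suc M) = cong suc (length-steps k 1 M)

fits : ∀ {N m} (k p : ℕ) → (Fin N → Bool) → Fin N → Vec (Fin N) m → Bool
fits k p B prev xs = (allIn B xs ∧ distinct xs) ∧ desOK k p (prev ∷ xs)

fits-∷ : ∀ {N m} k p (B : Fin N → Bool) prev x (xs : Vec (Fin N) m) →
  fits k p B prev (x ∷ xs)
    ≡ (B x ∧ ⌊ ⌊ toℕ x <? toℕ prev ⌋ ≟B ⌊ k ∣? p ⌋ ⌋) ∧ fits k (suc p) (delete B x) x xs
fits-∷ k p B prev x xs = begin
  ((B x ∧ allIn B xs) ∧ (noneEq x (toList xs) ∧ distinct xs)) ∧ (o ∧ desOK k (suc p) (x ∷ xs))
    ≡⟨ shuffle (B x) _ _ _ o _ ⟩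
  (B x ∧ o) ∧ (((allIn B xs ∧ noneEq x (toList xs)) ∧ distinct xs) ∧ desOK k (suc p) (x ∷ xs))
    ≡⟨ cong (λ a → (B x ∧ o) ∧ ((a ∧ distinct xs) ∧ desOK k (suc p) (x ∷ xs))) (allIn-delete B x xs) ⟨
  (B x ∧ o) ∧ fits k (suc p) (delete B x) x xs ∎
  where
  o = ⌊ ⌊ toℕ x <? toℕ prev ⌋ ≟B ⌊ k ∣? p ⌋ ⌋
  shuffle : ∀ b a n d o e → ((b ∧ a) ∧ (n ∧ d)) ∧ (o ∧ e) ≡ (b ∧ o) ∧ (((a ∧ n) ∧ d) ∧ e)
  shuffle = solve 6 (λ b a n d o e → ((b ⊕ a) ⊕ (n ⊕ d)) ⊕ (o ⊕ e) ⊜ (b ⊕ o) ⊕ (((a ⊕ n) ⊕ d) ⊕ e)) refl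

arrangements-fits : ∀ {N} k p m (B : Fin N → Bool) prev → size B ≡ m → B prev ≡ false →
  countᵇ (fits k p B prev) (allVecs N m) ≡ arrangements (steps k p m) (rank B prev)
arrangements-fits k p zero    B prev _ _ = refl
arrangements-fits {N} k p (suc m) B prev size≡ prev∉B = begin
  countᵇ (fits k p B prev) (allVecs N (suc m)) ≡⟨ countᵇ-allVecs-byRank _ B h byFirst ⟩
  sumFrom 0 (size B) h
    ≡⟨ cong (λ n → sumFrom 0 n h) (trans size≡ (cong suc (sym (length-steps k (suc p) m)))) ⟩
  arrangements (steps k p (suc m)) (rank B prev) ∎
  where
  rest = steps k (suc p) m
  h : ℕ → ℕ
  h j = if admits (stepAt k p) ⌊ j <? rank B prev ⌋ then arrangements rest j else 0
  byFirst : ∀ x → countᵇ (fits k p B prev ∘ (x ∷_)) (allVecs N m) ≡ (if B x then h (rank B x) else 0)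
  byFirst x = begin
    countᵇ (fits k p B prev ∘ (x ∷_)) (allVecs N m) ≡⟨ countᵇ-cong (fits-∷ k p B prev x) (allVecs N m) ⟩
    countᵇ (λ xs → (B x ∧ o) ∧ F xs) (allVecs N m)   ≡⟨ countᵇ-guard (B x ∧ o) F (allVecs N m) ⟩
    (if B x ∧ o then countᵇ F (allVecs N m) else 0)  ≡⟨ if-∧ (B x) o member ⟩
    (if B x then h (rank B x) else 0)                ∎
    where
    o = ⌊ ⌊ toℕ x <? toℕ prev ⌋ ≟B ⌊ k ∣? p ⌋ ⌋
    F = fits k (suc p) (delete B x) x
    member : B x ≡ true → (if o then countᵇ F (allVecs N m) else 0) ≡ h (rank B x)
    member x∈B = cong₂ (λ b n → if b then n else 0) o≡ (begin
      countᵇ F (allVecs N m)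
        ≡⟨ arrangements-fits k (suc p) m (delete B x) x size′ (delete-self B x) ⟩
      arrangements rest (rank (delete B x) x)
        ≡⟨ cong (arrangements rest) (rank-delete B x) ⟩
      arrangements rest (rank B x) ∎)
      where
      o≡ : o ≡ admits (stepAt k p) ⌊ rank B x <? rank B prev ⌋
      o≡ = trans (admits-descentIf ⌊ k ∣? p ⌋ _)
                 (cong (admits (stepAt k p)) (sym (rank-<? B x prev x∈B prev∉B)))
      size′ : size (delete B x) ≡ m
      size′ = suc-injective (trans (size-delete B x x∈B) size≡)

E-arrangements : ∀ k N → E N k ≡ arrangements₀ (eulerWord k N)
E-arrangements k zero    = refl
E-arrangements k (suc M) = begin
  E (suc M) k
    ≡⟨ cong length (filterᵇ-filterᵇ distinct (desOK k 1) (allVecs N N)) ⟩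
  length (filterᵇ P (allVecs N N))
    ≡⟨ length-filterᵇ P (allVecs N N) ⟩
  countᵇ P (allVecs N N)
    ≡⟨ countᵇ-allVecs-byRank P all (arrangements rest) byFirst ⟩
  sumFrom 0 (size all) (arrangements rest)
    ≡⟨ cong (λ n → sumFrom 0 n (arrangements rest))
            (trans (size-all N) (cong suc (sym (length-steps k 1 M)))) ⟩
  arrangements₀ (eulerWord k (suc M)) ∎
  where
  N = suc M
  rest = steps k 1 M
  P : Vec (Fin N) N → Bool
  P v = distinct v ∧ desOK k 1 v
  all : Fin N → Bool
  all _ = true
  size-all : ∀ n → size {n} (λ _ → true) ≡ n
  size-all zero    = refl
  size-all (suc n) = cong suc (size-all n)
  byFirst : ∀ x → countᵇ (P ∘ (x ∷_)) (allVecs N M) ≡ arrangements rest (rank all x)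
  byFirst x = begin
    countᵇ (P ∘ (x ∷_)) (allVecs N M)
      ≡⟨ countᵇ-cong (λ xs → cong (λ a → (a ∧ distinct xs) ∧ desOK k 1 (x ∷ xs)) (sym (allowed xs)))
                     (allVecs N M) ⟩
    countᵇ (fits k 1 (delete all x) x) (allVecs N M)
      ≡⟨ arrangements-fits k 1 M (delete all x) x (suc-injective (trans (size-delete all x refl) (size-all N)))
                           (delete-self all x) ⟩
    arrangements rest (rank (delete all x) x)
      ≡⟨ cong (arrangements rest) (rank-delete all x) ⟩
    arrangements rest (rank all x) ∎
    where
    allowed : ∀ xs → allIn (delete all x) xs ≡ noneEq x (toList xs)
    allowed xs = trans (allIn-delete all x xs) (cong (_∧ noneEq x (toList xs)) (allIn-all xs))

-- Removing the largest value

onlyIf : Bool → X → List X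
onlyIf b x = if b then x ∷ [] else []

All-onlyIf : ∀ {P : X → Set} b {x} → (T b → P x) → All P (onlyIf b x)
All-onlyIf true  p = p _ ∷ []
All-onlyIf false p = []

sum-onlyIf : (f : X → ℕ) (b : Bool) (x : X) → sum (map f (onlyIf b x)) ≡ (if b then f x else 0)
sum-onlyIf f true  x = +-identityʳ (f x)
sum-onlyIf f false x = refl

map-onlyIf : (f : X → Y) (b : Bool) (x : X) → map f (onlyIf b x) ≡ onlyIf b (f x)
map-onlyIf f true  x = refl
map-onlyIf f false x = refl

-- The largest value sits at a peak: it is entered by a step admitting an ascent and, unless it is
-- last, left by a step admitting a descent. Deleting it merges these two steps into a free one.
peakRemovals : Word → List Word
peakRemovals []          = []
peakRemovals (c ∷ [])    = onlyIf (admits c false) []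
peakRemovals (c ∷ d ∷ w) =
  onlyIf (admits c false ∧ admits d true) (free ∷ w) ++ map (c ∷_) (peakRemovals (d ∷ w))

length-peakRemovals : ∀ w → All (λ v → suc (length v) ≡ length w) (peakRemovals w)
length-peakRemovals []          = []
length-peakRemovals (c ∷ [])    = All-onlyIf (admits c false) (λ _ → refl)
length-peakRemovals (c ∷ d ∷ w) =
  ++⁺ (All-onlyIf (admits c false ∧ admits d true) (λ _ → refl))
      (map⁺ (All.map (cong suc) (length-peakRemovals (d ∷ w))))

All-peakRemovals : ∀ {P : Word → Set} w
  → (∀ s d v → drop (suc s) w ≡ d ∷ v → T (admits d true) → P (take s w ++ free ∷ v))
  → (∀ s c → drop s w ≡ c ∷ [] → T (admits c false) → P (take s w))
  → All P (peakRemovals w)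
All-peakRemovals []          atPeak atEnd = []
All-peakRemovals (c ∷ [])    atPeak atEnd = All-onlyIf (admits c false) (atEnd 0 c refl)
All-peakRemovals (c ∷ d ∷ w) atPeak atEnd =
  ++⁺ (All-onlyIf (admits c false ∧ admits d true) (atPeak 0 d w refl ∘ proj₂ ∘ Equivalence.to T-∧))
      (map⁺ (All-peakRemovals (d ∷ w) (atPeak ∘ suc) (atEnd ∘ suc)))

arrangements-firstLargest : ∀ c d w r → r ≤ suc (length w) →
  (if admits c ⌊ suc (length w) <? r ⌋ then arrangements (d ∷ w) (suc (length w)) else 0)
    ≡ (if admits c false ∧ admits d true then arrangements (free ∷ w) r else 0)
arrangements-firstLargest c d w r r≤1+n = begin
  (if admits c ⌊ suc n <? r ⌋ then arrangements (d ∷ w) (suc n) else 0)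
    ≡⟨ cong (λ b → if admits c b then arrangements (d ∷ w) (suc n) else 0)
            (⌊⌋-false (suc n <? r) (≤⇒≯ r≤1+n)) ⟩
  (if admits c false then arrangements (d ∷ w) (suc n) else 0)
    ≡⟨ cong (λ s → if admits c false then s else 0) (sumFrom-cong 0 (suc n) λ j j<1+n →
         cong (λ b → if admits d b then arrangements w j else 0) (⌊⌋-true (j <? suc n) j<1+n)) ⟩
  (if admits c false then sumFrom 0 (suc n) (λ j → if admits d true then arrangements w j else 0) else 0)
    ≡⟨ guards (admits c false) (admits d true) ⟩
  (if admits c false ∧ admits d true then arrangements (free ∷ w) r else 0) ∎
  where
  n = length w
  guards : ∀ a b → (if a then sumFrom 0 (suc n) (λ j → if b then arrangements w j else 0) else 0)
                   ≡ (if a ∧ b then sumFrom 0 (suc n) (arrangements w) else 0)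
  guards true  true  = refl
  guards true  false = sumFrom-zero 0 (suc n)
  guards false b     = refl

-- Since r < length w, the value listed before w is not the largest, so the largest value is in w.
arrangements-peakRemovals : ∀ w r → r < length w →
  arrangements w r ≡ sum (map (λ v → arrangements v r) (peakRemovals w))
arrangements-peakRemovals (asc  ∷ []) zero _ = refl
arrangements-peakRemovals (desc ∷ []) zero _ = refl
arrangements-peakRemovals (free ∷ []) zero _ = refl
arrangements-peakRemovals (c ∷ []) (suc r) (s≤s ())
arrangements-peakRemovals (c ∷ dw@(d ∷ w)) r (s≤s r≤1+n) = begin
  arrangements (c ∷ d ∷ w) r                   ≡⟨ sumFrom-last 0 (suc n) H ⟩
  sumFrom 0 (suc n) H + H (suc n)              ≡⟨ cong₂ _+_ (notFirst (arrangements-peakRemovals dw)) first ⟩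
  sum (map f (map (c ∷_) R)) + sum (map f top) ≡⟨ +-comm (sum (map f (map (c ∷_) R))) _ ⟩
  sum (map f top) + sum (map f (map (c ∷_) R)) ≡⟨ sum-map-++ f top (map (c ∷_) R) ⟨
  sum (map f (peakRemovals (c ∷ d ∷ w)))       ∎
  where
  n = length w
  G : Word → ℕ → ℕ
  G v j = if admits c ⌊ j <? r ⌋ then arrangements v j else 0
  H : ℕ → ℕ
  H = G dw
  f : Word → ℕ
  f v = arrangements v r
  R = peakRemovals dw
  top = onlyIf (admits c false ∧ admits d true) (free ∷ w)
  first : H (suc n) ≡ sum (map f top)
  first = trans (arrangements-firstLargest c d w r r≤1+n) (sym (sum-onlyIf f _ (free ∷ w)))
  notFirst : (∀ j → j < length dw → arrangements dw j ≡ sum (map (λ v → arrangements v j) R)) →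
             sumFrom 0 (suc n) H ≡ sum (map f (map (c ∷_) R))
  notFirst ih = begin
    sumFrom 0 (suc n) H
      ≡⟨ sumFrom-cong 0 (suc n) (λ j j<1+n →
           trans (cong (λ s → if admits c ⌊ j <? r ⌋ then s else 0) (ih j j<1+n))
                 (if-sum-map (admits c ⌊ j <? r ⌋) (λ v → arrangements v j) R)) ⟩
    sumFrom 0 (suc n) (λ j → sum (map (λ v → G v j) R))
      ≡⟨ sumFrom-sum 0 (suc n) G R ⟩
    sum (map (λ v → sumFrom 0 (suc n) (G v)) R)
      ≡⟨ cong sum (map-cong-local (All.map
           (λ {v} |v|≡ → cong (λ l → sumFrom 0 (suc l) (G v)) (suc-injective (sym |v|≡)))
           (length-peakRemovals dw))) ⟩
    sum (map (λ v → arrangements (c ∷ v) r) R)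
      ≡⟨ cong sum (map-∘ R) ⟩
    sum (map f (map (c ∷_) R)) ∎

StartsFree : Word → Set
StartsFree []      = ⊤
StartsFree (c ∷ _) = c ≡ free

peakRemovals-++ : ∀ w₁ w₂ → StartsFree w₂ →
  peakRemovals (w₁ ++ w₂) ≡ map (_++ w₂) (peakRemovals w₁) ++ map (w₁ ++_) (peakRemovals w₂)
peakRemovals-++ []          w₂       _    = sym (map-id (peakRemovals w₂))
peakRemovals-++ (asc  ∷ []) []       _    = refl
peakRemovals-++ (desc ∷ []) []       _    = refl
peakRemovals-++ (free ∷ []) []       _    = refl
peakRemovals-++ (asc  ∷ []) (._ ∷ w) refl = refl
peakRemovals-++ (desc ∷ []) (._ ∷ w) refl = refl
peakRemovals-++ (free ∷ []) (._ ∷ w) refl = refl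
peakRemovals-++ w₁@(c ∷ dw@(d ∷ w)) w₂ free₂ = begin
  top (w ++ w₂) ++ map (c ∷_) (peakRemovals (dw ++ w₂))
    ≡⟨ cong (λ rs → top (w ++ w₂) ++ map (c ∷_) rs) (peakRemovals-++ dw w₂ free₂) ⟩
  top (w ++ w₂) ++ map (c ∷_) (map (_++ w₂) R₁ ++ map (dw ++_) R₂)
    ≡⟨ cong (top (w ++ w₂) ++_) (map-++ (c ∷_) (map (_++ w₂) R₁) (map (dw ++_) R₂)) ⟩
  top (w ++ w₂) ++ (map (c ∷_) (map (_++ w₂) R₁) ++ map (c ∷_) (map (dw ++_) R₂))
    ≡⟨ cong₂ (λ xs ys → top (w ++ w₂) ++ (xs ++ ys)) (trans (sym (map-∘ R₁)) (map-∘ R₁)) (sym (map-∘ R₂)) ⟩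
  top (w ++ w₂) ++ (map (_++ w₂) (map (c ∷_) R₁) ++ map (w₁ ++_) R₂)
    ≡⟨ ++-assoc (top (w ++ w₂)) _ _ ⟨
  (top (w ++ w₂) ++ map (_++ w₂) (map (c ∷_) R₁)) ++ map (w₁ ++_) R₂
    ≡⟨ cong (λ xs → (xs ++ map (_++ w₂) (map (c ∷_) R₁)) ++ map (w₁ ++_) R₂)
            (map-onlyIf (_++ w₂) b (free ∷ w)) ⟨
  (map (_++ w₂) (top w) ++ map (_++ w₂) (map (c ∷_) R₁)) ++ map (w₁ ++_) R₂
    ≡⟨ cong (_++ map (w₁ ++_) R₂) (map-++ (_++ w₂) (top w) (map (c ∷_) R₁)) ⟨
  map (_++ w₂) (peakRemovals w₁) ++ map (w₁ ++_) R₂ ∎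
  where
  b = admits c false ∧ admits d true
  top : Word → List Word
  top u = onlyIf b (free ∷ u)
  R₁ = peakRemovals dw
  R₂ = peakRemovals w₂

peakRemovals-startsFree : ∀ w → All StartsFree (peakRemovals (free ∷ w))
peakRemovals-startsFree []      = tt ∷ []
peakRemovals-startsFree (d ∷ w) =
  ++⁺ (All-onlyIf (admits d true) (λ _ → refl)) (map⁺ (All.universal (λ _ → refl) (peakRemovals (d ∷ w))))

private
  SplitsAt : ℕ → Set
  SplitsAt n = ∀ w₁ w₂ → length w₁ + length w₂ ≡ n → StartsFree w₂ →
    arrangements₀ (w₁ ++ w₂) ≡ ((length w₁ + length w₂) C length w₁) * arrangements₀ w₁ * arrangements₀ w₂

  splitsAt-left : ∀ {n} → SplitsAt n → ∀ c s w₂ → length (c ∷ s) + length w₂ ≡ suc n → StartsFree w₂ →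
    sum (map arrangements₀ (map (_++ w₂) (peakRemovals (c ∷ s))))
      ≡ ((n C length s) * arrangements₀ w₂) * arrangements₀ (c ∷ s)
  splitsAt-left {n} splits c s w₂ len free₂ = begin
    sum (map arrangements₀ (map (_++ w₂) (peakRemovals w₁))) ≡⟨ cong sum (map-∘ (peakRemovals w₁)) ⟨
    sum (map (arrangements₀ ∘ (_++ w₂)) (peakRemovals w₁))
      ≡⟨ sum-map-scale K (All.map (λ {v} → each {v}) (length-peakRemovals w₁)) ⟩
    K * sum (map arrangements₀ (peakRemovals w₁))
      ≡⟨ cong (K *_) (arrangements-peakRemovals w₁ 0 (s≤s z≤n)) ⟨
    K * arrangements₀ w₁ ∎
    where
    w₁ = c ∷ s
    K = (n C length s) * arrangements₀ w₂
    swap : ∀ x y z → x * y * z ≡ (x * z) * y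
    swap = solve-∀
    each : ∀ {v} → suc (length v) ≡ length w₁ → arrangements₀ (v ++ w₂) ≡ K * arrangements₀ v
    each {v} |v|≡ = begin
      arrangements₀ (v ++ w₂)
        ≡⟨ splits v w₂ |v|+|w₂|≡n free₂ ⟩
      ((length v + length w₂) C length v) * arrangements₀ v * arrangements₀ w₂
        ≡⟨ cong₂ (λ t l → (t C l) * arrangements₀ v * arrangements₀ w₂) |v|+|w₂|≡n (suc-injective |v|≡) ⟩
      (n C length s) * arrangements₀ v * arrangements₀ w₂
        ≡⟨ swap (n C length s) (arrangements₀ v) (arrangements₀ w₂) ⟩
      K * arrangements₀ v ∎
      where
      |v|+|w₂|≡n = trans (cong (_+ length w₂) (suc-injective |v|≡)) (suc-injective len)

  splitsAt-right : ∀ {n} → SplitsAt n → ∀ w₁ w₂ → length w₁ + length w₂ ≡ suc n → StartsFree w₂ →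
    sum (map arrangements₀ (map (w₁ ++_) (peakRemovals w₂)))
      ≡ ((n C length w₁) * arrangements₀ w₁) * arrangements₀ w₂
  splitsAt-right {n} splits w₁ [] len _ =
    cong (λ x → x * arrangements₀ w₁ * 1)
         (sym (k>n⇒nCk≡0 (≤-reflexive (trans (sym len) (+-identityʳ (length w₁))))))
  splitsAt-right {n} splits w₁ w₂@(._ ∷ q) len refl = begin
    sum (map arrangements₀ (map (w₁ ++_) (peakRemovals w₂))) ≡⟨ cong sum (map-∘ (peakRemovals w₂)) ⟨
    sum (map (arrangements₀ ∘ (w₁ ++_)) (peakRemovals w₂))
      ≡⟨ sum-map-scale K (All.map (λ {v} → each {v})
                                  (All.zip (length-peakRemovals w₂ , peakRemovals-startsFree q))) ⟩
    K * sum (map arrangements₀ (peakRemovals w₂))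
      ≡⟨ cong (K *_) (arrangements-peakRemovals w₂ 0 (s≤s z≤n)) ⟨
    K * arrangements₀ w₂ ∎
    where
    K = (n C length w₁) * arrangements₀ w₁
    each : ∀ {v} → suc (length v) ≡ length w₂ × StartsFree v → arrangements₀ (w₁ ++ v) ≡ K * arrangements₀ v
    each {v} (|v|≡ , free-v) =
      trans (splits w₁ v |w₁|+|v|≡n free-v)
            (cong (λ t → (t C length w₁) * arrangements₀ w₁ * arrangements₀ v) |w₁|+|v|≡n)
      where
      |w₁|+|v|≡n =
        suc-injective (trans (sym (+-suc (length w₁) (length v))) (trans (cong (length w₁ +_) |v|≡) len))

  -- The largest value lies in one of the two blocks; removing it leaves shorter blocks,
  -- and Pascal's rule reassembles the binomial coefficient.
  splitsAt : ∀ n → SplitsAt n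
  splitsAt n       []          w₂ _   _     = sym (+-identityʳ (arrangements₀ w₂))
  splitsAt zero    (c ∷ s)     w₂ ()  _
  splitsAt (suc n) w₁@(c ∷ s) w₂ len free₂ = begin
    arrangements₀ (w₁ ++ w₂)
      ≡⟨ arrangements-peakRemovals (w₁ ++ w₂) 0 (s≤s z≤n) ⟩
    sum (map arrangements₀ (peakRemovals (w₁ ++ w₂)))
      ≡⟨ cong (sum ∘ map arrangements₀) (peakRemovals-++ w₁ w₂ free₂) ⟩
    sum (map arrangements₀ (map (_++ w₂) (peakRemovals w₁) ++ map (w₁ ++_) (peakRemovals w₂)))
      ≡⟨ sum-map-++ arrangements₀ (map (_++ w₂) (peakRemovals w₁)) _ ⟩
    sum (map arrangements₀ (map (_++ w₂) (peakRemovals w₁)))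
      + sum (map arrangements₀ (map (w₁ ++_) (peakRemovals w₂)))
      ≡⟨ cong₂ _+_ (splitsAt-left (splitsAt n) c s w₂ len free₂)
                   (splitsAt-right (splitsAt n) w₁ w₂ len free₂) ⟩
    ((n C length s) * a₂) * a₁ + ((n C length w₁) * a₁) * a₂
      ≡⟨ collect (n C length s) (n C length w₁) a₁ a₂ ⟩
    (n C length s + n C length w₁) * a₁ * a₂
      ≡⟨ cong (λ x → x * a₁ * a₂) (nCk+nC[k+1]≡[n+1]C[k+1] n (length s)) ⟩
    (suc n C length w₁) * a₁ * a₂
      ≡⟨ cong (λ t → (t C length w₁) * a₁ * a₂) len ⟨
    ((length w₁ + length w₂) C length w₁) * a₁ * a₂ ∎
    where
    a₁ = arrangements₀ w₁
    a₂ = arrangements₀ w₂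
    collect : ∀ x y a b → (x * b) * a + (y * a) * b ≡ (x + y) * a * b
    collect = solve-∀

arrangements₀-++ : ∀ w₁ w₂ → StartsFree w₂ →
  arrangements₀ (w₁ ++ w₂) ≡ ((length w₁ + length w₂) C length w₁) * arrangements₀ w₁ * arrangements₀ w₂
arrangements₀-++ w₁ w₂ = splitsAt _ w₁ w₂ refl

absorption : ∀ m t → suc m * (m C t) ≡ suc t * (suc m C suc t)
absorption zero    zero    = refl
absorption zero    (suc t) = sym (*-zeroʳ (suc (suc t)))
absorption (suc m) zero    =
  trans (*-identityʳ (suc (suc m))) (sym (trans (+-identityʳ _) (nC1≡n (suc (suc m)))))
absorption (suc m) (suc t) = begin
  suc (suc m) * c                           ≡⟨ +-comm c (suc m * c) ⟩
  suc m * c + c                             ≡⟨ cong (λ x → suc m * x + c) (nCk+nC[k+1]≡[n+1]C[k+1] m t) ⟨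
  suc m * (m C t + m C suc t) + c           ≡⟨ cong (_+ c) (*-distribˡ-+ (suc m) (m C t) (m C suc t)) ⟩
  suc m * (m C t) + suc m * (m C suc t) + c ≡⟨ cong₂ (λ x y → x + y + c) (absorption m t) (absorption m (suc t)) ⟩
  suc t * c + suc (suc t) * d + c           ≡⟨ regroup (suc t) c d ⟩
  suc (suc t) * (c + d)                     ≡⟨ cong (suc (suc t) *_) (nCk+nC[k+1]≡[n+1]C[k+1] (suc m) (suc t)) ⟩
  suc (suc t) * (suc (suc m) C suc (suc t)) ∎
  where
  c = suc m C suc t
  d = suc m C suc (suc t)
  regroup : ∀ u c d → u * c + suc u * d + c ≡ suc u * (c + d)
  regroup = solve-∀

prime∣binomial : ∀ {p} t d → Prime p → p ∣ suc t → ¬ p ∣ d → p ∣ (t + d) C t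
prime∣binomial {p} t d p-prime p∣1+t p∤d =
  [ (λ p∣d → contradiction p∣d p∤d) , id ]′
    (euclidsLemma d c₀ p-prime (subst (p ∣_) (sym d*c₀≡) (∣m⇒∣m*n c₁ p∣1+t)))
  where
  c₀ = (t + d) C t
  c₁ = (t + d) C suc t
  d*c₀≡ : d * c₀ ≡ suc t * c₁
  d*c₀≡ = +-cancelˡ-≡ (suc t * c₀) _ _ (begin
    suc t * c₀ + d * c₀           ≡⟨ *-distribʳ-+ c₀ (suc t) d ⟨
    suc (t + d) * c₀              ≡⟨ absorption (t + d) t ⟩
    suc t * (suc (t + d) C suc t) ≡⟨ cong (suc t *_) (nCk+nC[k+1]≡[n+1]C[k+1] (t + d) t) ⟨
    suc t * (c₀ + c₁)             ≡⟨ *-distribˡ-+ (suc t) c₀ c₁ ⟩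
    suc t * c₀ + suc t * c₁       ∎)

stepAt-descent : ∀ k p → T (admits (stepAt k p) true) → k ∣ p
stepAt-descent k p = toWitness ∘ descent-admitted ⌊ k ∣? p ⌋

stepAt-ascent : ∀ k p → T (admits (stepAt k p) false) → ¬ k ∣ p
stepAt-ascent k p = toWitnessFalse ∘ ascent-admitted ⌊ k ∣? p ⌋

stepAt-periodic : ∀ k p {x} → k ∣ x → stepAt k (p + x) ≡ stepAt k p
stepAt-periodic k p {x} k∣x = cong descentIf (⌊⌋-cong
  (mk⇔ (λ k∣p+x → ∣m+n∣m⇒∣n (subst (k ∣_) (+-comm p x) k∣p+x) k∣x)
        (λ k∣p → ∣m∣n⇒∣m+n k∣p k∣x))
  (k ∣? (p + x)) (k ∣? p))

steps-periodic : ∀ k p m {x} → k ∣ x → steps k (p + x) m ≡ steps k p m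
steps-periodic k p zero    k∣x = refl
steps-periodic k p (suc m) k∣x = cong₂ _∷_ (stepAt-periodic k p k∣x) (steps-periodic k (suc p) m k∣x)

take-steps : ∀ k p {s m} → s ≤ m → take s (steps k p m) ≡ steps k p s
take-steps k p z≤n       = refl
take-steps k p (s≤s s≤m) = cong (stepAt k p ∷_) (take-steps k (suc p) s≤m)

drop-steps : ∀ k p s m → drop s (steps k p m) ≡ steps k (p + s) (m ∸ s)
drop-steps k p zero    m       = cong (λ q → steps k q m) (sym (+-identityʳ p))
drop-steps k p (suc s) zero    = refl
drop-steps k p (suc s) (suc m) =
  trans (drop-steps k (suc p) s m) (cong (λ q → steps k q (m ∸ s)) (sym (+-suc p s)))

take-eulerWord : ∀ k {s N} → s ≤ N → take s (eulerWord k N) ≡ eulerWord k s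
take-eulerWord k z≤n       = refl
take-eulerWord k (s≤s s≤N) = cong (free ∷_) (take-steps k 1 s≤N)

startsFree-eulerWord : ∀ k N → StartsFree (eulerWord k N)
startsFree-eulerWord k zero    = tt
startsFree-eulerWord k (suc N) = refl

∸≡suc⇒+≡ : ∀ m n {r} → m ∸ n ≡ suc r → n + suc r ≡ m
∸≡suc⇒+≡ zero    zero    ()
∸≡suc⇒+≡ zero    (suc n) ()
∸≡suc⇒+≡ (suc m) zero    eq = sym eq
∸≡suc⇒+≡ (suc m) (suc n) eq = cong suc (∸≡suc⇒+≡ m n eq)

-- The recurrence for E

module _ {P : Word → Set} (k N : ℕ)
         (blocks : ∀ s d → k ∣ suc s → s + d ≡ N → P (eulerWord k s ++ eulerWord k d))
         (last : N ≡ 0 ⊎ ¬ k ∣ N → P (eulerWord k N)) where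

  private
    peakInside : ∀ s r {d v} → N ∸ s ≡ r → steps k (suc s) r ≡ d ∷ v → T (admits d true) →
                 P (take s (eulerWord k (suc N)) ++ free ∷ v)
    peakInside s (suc r) N∸s≡1+r refl descent =
      subst₂ (λ u w → P (u ++ w))
             (sym (take-eulerWord k s≤1+N)) (cong (free ∷_) (sym (steps-periodic k 1 r k∣1+s)))
             (blocks s (suc r) k∣1+s s+1+r≡N)
      where
      k∣1+s = stepAt-descent k (suc s) descent
      s+1+r≡N = ∸≡suc⇒+≡ N s N∸s≡1+r
      s≤1+N = m≤n⇒m≤1+n (≤-trans (m≤m+n s (suc r)) (≤-reflexive s+1+r≡N))

    peakLast : ∀ s r {c} → N ∸ s ≡ r → steps k (suc s) r ≡ c ∷ [] → T (admits c false) →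
               P (take (suc s) (eulerWord k (suc N)))
    peakLast s (suc zero) N∸s≡1 refl ascent =
      subst P (sym (take-eulerWord k (m≤n⇒m≤1+n (≤-reflexive 1+s≡N))))
        (subst (P ∘ eulerWord k) (sym 1+s≡N)
          (last (inj₂ (subst (λ n → ¬ k ∣ n) 1+s≡N (stepAt-ascent k (suc s) ascent)))))
      where
      1+s≡N : suc s ≡ N
      1+s≡N = trans (+-comm 1 s) (∸≡suc⇒+≡ N s N∸s≡1)

    peakAtEnd : ∀ s c → drop s (eulerWord k (suc N)) ≡ c ∷ [] → T (admits c false) →
                P (take s (eulerWord k (suc N)))
    peakAtEnd zero    c eq _ = subst (P ∘ eulerWord k) N≡0 (last (inj₁ N≡0))
      where
      N≡0 : N ≡ 0
      N≡0 = trans (sym (length-steps k 1 N)) (cong (λ w → length w ∸ 1) eq)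
    peakAtEnd (suc s) c eq = peakLast s (N ∸ s) refl (trans (sym (drop-steps k 1 s N)) eq)

  peakRemovals-eulerWord : All P (peakRemovals (eulerWord k (suc N)))
  peakRemovals-eulerWord = All-peakRemovals (eulerWord k (suc N))
    (λ s d v eq → peakInside s (N ∸ s) refl (trans (sym (drop-steps k 1 s N)) eq))
    peakAtEnd

arrangements₀-eulerWord-++ : ∀ k s d →
  arrangements₀ (eulerWord k s ++ eulerWord k d) ≡ ((s + d) C s) * E s k * E d k
arrangements₀-eulerWord-++ k s d = begin
  arrangements₀ (w₁ ++ w₂)
    ≡⟨ arrangements₀-++ w₁ w₂ (startsFree-eulerWord k d) ⟩
  ((length w₁ + length w₂) C length w₁) * arrangements₀ w₁ * arrangements₀ w₂
    ≡⟨ cong₂ (λ a b → ((a + b) C a) * arrangements₀ w₁ * arrangements₀ w₂)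
             (length-eulerWord k s) (length-eulerWord k d) ⟩
  ((s + d) C s) * arrangements₀ w₁ * arrangements₀ w₂
    ≡⟨ cong₂ (λ a b → ((s + d) C s) * a * b) (E-arrangements k s) (E-arrangements k d) ⟨
  ((s + d) C s) * E s k * E d k ∎
  where
  w₁ = eulerWord k s
  w₂ = eulerWord k d

∣-E-suc : ∀ {x} k N
  → (∀ s d → k ∣ suc s → s + d ≡ N → x ∣ (N C s) * E s k * E d k)
  → (N ≡ 0 ⊎ ¬ k ∣ N → x ∣ E N k)
  → x ∣ E (suc N) k
∣-E-suc {x} k N blocks last =
  subst (x ∣_)
        (sym (trans (E-arrangements k (suc N)) (arrangements-peakRemovals (eulerWord k (suc N)) 0 (s≤s z≤n))))
        (∣-sum-map arrangements₀ (peakRemovals-eulerWord k N blocks′ last′))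
  where
  blocks′ : ∀ s d → k ∣ suc s → s + d ≡ N → x ∣ arrangements₀ (eulerWord k s ++ eulerWord k d)
  blocks′ s d k∣1+s s+d≡N =
    subst (x ∣_)
          (sym (trans (arrangements₀-eulerWord-++ k s d) (cong (λ n → (n C s) * E s k * E d k) s+d≡N)))
          (blocks s d k∣1+s s+d≡N)
  last′ : N ≡ 0 ⊎ ¬ k ∣ N → x ∣ arrangements₀ (eulerWord k N)
  last′ = subst (x ∣_) (E-arrangements k N) ∘ last

-- Divisibility by powers of k

quotient-split : ∀ {k} j n {d r} → r < k → j * k + d ≡ n * k + r → ∃[ m ] n ≡ j + m × d ≡ m * k + r
quotient-split zero n r<k eq = n , refl , eq
quotient-split {k} (suc j) zero {d} r<k eq =
  contradiction (≤-trans (≤-trans (m≤m+n k (j * k)) (m≤m+n (k + j * k) d)) (≤-reflexive eq)) (<⇒≱ r<k)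
quotient-split {k} (suc j) (suc n) {d} {r} r<k eq
  with quotient-split j n r<k
         (+-cancelˡ-≡ k _ _ (trans (sym (+-assoc k (j * k) d)) (trans eq (+-assoc k (n * k) r))))
... | m , n≡j+m , d≡ = m , cong suc n≡j+m , d≡

nonzero-remainder⇒∤ : ∀ {k} m {r} → 0 < r → r < k → ¬ k ∣ m * k + r
nonzero-remainder⇒∤ m {suc r} _ r<k k∣ = <⇒≱ r<k (∣⇒≤ (∣m+n∣m⇒∣n k∣ (n∣m*n m)))

-- With k = 2 + k₂, the residues 0 < i < k are exactly the numbers suc a with a ≤ k₂.
module _ (k₂ : ℕ) (k-prime : Prime (2 + k₂)) where

  private
    k = 2 + k₂

    DividesAt : ℕ → Set
    DividesAt n = ∀ a → a ≤ k₂ → k ^ n ∣ E (n * k + suc a) k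

    blocks-∣ : ∀ n a → a ≤ k₂ → (∀ {m} → m < suc n → DividesAt m) →
               ∀ s d → k ∣ suc s → s + d ≡ suc n * k + a → k ^ suc n ∣ ((suc n * k + a) C s) * E s k * E d k
    blocks-∣ n a a≤k₂ ih s d (divides zero ()) _
    blocks-∣ n a a≤k₂ ih s d (divides (suc j) 1+s≡) s+d≡
      with quotient-split (suc j) (suc n) (s≤s (s≤s a≤k₂))
             (trans (cong (_+ d) (sym 1+s≡)) (trans (cong suc s+d≡) (sym (+-suc (suc n * k) a))))
    ... | m , 1+n≡1+j+m , d≡ =
      subst (_∣ ((suc n * k + a) C s) * E s k * E d k) (sym k^1+n≡)
            (*-pres-∣ (*-pres-∣ k∣C k^j∣E) k^m∣E)
      where
      n≡j+m = suc-injective 1+n≡1+j+m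
      k^1+n≡ : k ^ suc n ≡ k * k ^ j * k ^ m
      k^1+n≡ = trans (cong (k ^_) 1+n≡1+j+m) (^-distribˡ-+-* k (suc j) m)
      k∣C : k ∣ (suc n * k + a) C s
      k∣C = subst (λ x → k ∣ x C s) s+d≡
        (prime∣binomial s d k-prime (divides (suc j) 1+s≡)
          (subst (λ x → ¬ k ∣ x) (sym d≡) (nonzero-remainder⇒∤ m (s≤s z≤n) (s≤s (s≤s a≤k₂)))))
      k^j∣E : k ^ j ∣ E s k
      k^j∣E = subst (λ x → k ^ j ∣ E x k) (sym (trans (suc-injective 1+s≡) (+-comm (suc k₂) (j * k))))
        (ih (s≤s (≤-trans (m≤m+n j m) (≤-reflexive (sym n≡j+m)))) k₂ ≤-refl)
      k^m∣E : k ^ m ∣ E d k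
      k^m∣E = subst (λ x → k ^ m ∣ E x k) (sym d≡)
        (ih (s≤s (≤-trans (m≤n+m m j) (≤-reflexive (sym n≡j+m)))) a a≤k₂)

  k^n∣E : ∀ n a → a ≤ k₂ → k ^ n ∣ E (n * k + suc a) k
  k^n∣E = <-rec DividesAt step
    where
    step : ∀ n → (∀ {m} → m < n → DividesAt m) → DividesAt n
    step zero    _  _ _    = 1∣ _
    step (suc n) ih a a≤k₂ =
      subst (λ x → k ^ suc n ∣ E x k) (sym (+-suc (suc n * k) a))
            (∣-E-suc k (suc n * k + a) (blocks-∣ n a a≤k₂ ih) (last a a≤k₂))
      where
      last : ∀ a → a ≤ k₂ → suc n * k + a ≡ 0 ⊎ ¬ k ∣ suc n * k + a → k ^ suc n ∣ E (suc n * k + a) k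
      last zero    _      (inj₁ ())
      last zero    _      (inj₂ k∤) =
        contradiction (subst (k ∣_) (sym (+-identityʳ (suc n * k))) (n∣m*n (suc n))) k∤
      last (suc a) 1+a≤k₂ _         = step (suc n) ih a (≤-trans (n≤1+n a) 1+a≤k₂)

corollary4p1 : (k i n : ℕ) → Prime k → 1 ≤ i → i ≤ k ∸ 1 →
    k ^ n ∣ E (n * k + i) k
corollary4p1 k              zero    n _       () _
corollary4p1 zero           (suc a) n _       _  ()
corollary4p1 (suc zero)     (suc a) n _       _  ()
corollary4p1 (suc (suc k₂)) (suc a) n k-prime _  (s≤s a≤k₂) = k^n∣E k₂ k-prime n a a≤k₂
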